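{- Let $k,n$ be integers with $k\geq 1$ and $n\geq k+3$, and let $u$ be the natural number with base-$4$ expansion $(u)_4=1\,3^{(k)}\,2\,3^{(n)}$. Then $s_4(2u^2)=3n$.
   Context: $s_4(n)$ denotes the sum of the digits of $n$ in base $4$. In a digit string, $x^{(a)}$ denotes the digit $x$ repeated $a$ times consecutively, read from most to least significant digit; so $(u)_4$ is a $1$, then $k$ digits $3$, then a $2$, then $n$ digits $3$. -}

module Defs where

open import Data.Nat using (ℕ; zero; suc; _+_; _*_; _/_; _%_)
open import Data.List using (List; []; _∷_; _++_; replicate; foldl)

-- Sum of base-4 digits of n.  The fuel argument (n itself) bounds the number of
-- digits; since n / 4 < n for n > 0, fuel n suffices to exhaust all digits.
s4-fuel : ℕ → ℕ → ℕ
s4-fuel zero    n = 0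
s4-fuel (suc f) n = n % 4 + s4-fuel f (n / 4)

s₄ : ℕ → ℕ
s₄ n = s4-fuel n n

fromDigits₄ : List ℕ → ℕ
fromDigits₄ = foldl (λ acc d → 4 * acc + d) 0

u : ℕ → ℕ → ℕ
u k n = fromDigits₄ (1 ∷ replicate k 3 ++ 2 ∷ replicate n 3)

module Submission where

-- For n = k + 3 + m the expansion of 2u² is
--   (2u²)₄ = 1 3^(k) 2 0^(k+1) 1 3^(m) 2 0^(k) 1 0^(n) 2 ,
-- whose digit sum is 3k + 3m + 9 = 3n.  Checking that this string has value 2u²
-- uses u + 1 = cN with c = 8·4^k - 1 and N = 4^n = 64·4^k·4^m, which reduces it
-- to small ring identities.

open import Defs
open import Data.Nat using (ℕ; zero; suc; _+_; _*_; _≤_; _<_; _^_; _%_; _/_; _<?_; s≤s; s≤s⁻¹; z≤n)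
open import Data.Nat.Properties
open import Data.Nat.DivMod using (%-remove-+ˡ; +-distrib-/-∣ˡ; m*n/n≡m; m<n⇒m%n≡m; m<n⇒m/n≡0; m/n<m)
open import Data.Nat.Divisibility using (n∣m*n)
open import Data.Nat.ListAction using (sum)
open import Data.Nat.ListAction.Properties using (sum-++)
open import Data.Nat.Tactic.RingSolver using (solve-∀)
open import Data.List using (List; []; _∷_; _++_; replicate; foldl; length)
open import Data.List.Properties using (foldl-++; ++-identityʳ)
open import Data.List.Relation.Unary.All using (All; []; _∷_; all?)
open import Data.List.Relation.Unary.All.Properties using (++⁺; replicate⁺)
open import Data.Product using (_×_; _,_; proj₁)
open import Relation.Binary.PropositionalEquality
open import Relation.Nullary.Decidable using (toWitness)
open import Data.Unit using (tt)
open ≡-Reasoning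

push : ℕ → ℕ → ℕ
push acc d = 4 * acc + d

s4-fuel-push : ∀ f acc {d} → d < 4 → s4-fuel (suc f) (push acc d) ≡ d + s4-fuel f acc
s4-fuel-push f acc {d} d<4 = cong₂ (λ r q → r + s4-fuel f q) remainder quotient
  where
  swap : push acc d ≡ acc * 4 + d
  swap = cong (_+ d) (*-comm 4 acc)
  remainder : push acc d % 4 ≡ d
  remainder = begin
    push acc d % 4    ≡⟨ cong (_% 4) swap ⟩
    (acc * 4 + d) % 4 ≡⟨ %-remove-+ˡ d (n∣m*n acc) ⟩
    d % 4             ≡⟨ m<n⇒m%n≡m d<4 ⟩
    d                 ∎
  quotient : push acc d / 4 ≡ acc
  quotient = begin
    push acc d / 4      ≡⟨ cong (_/ 4) swap ⟩
    (acc * 4 + d) / 4   ≡⟨ +-distrib-/-∣ˡ d (n∣m*n acc) ⟩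
    acc * 4 / 4 + d / 4 ≡⟨ cong₂ _+_ (m*n/n≡m acc 4) (m<n⇒m/n≡0 d<4) ⟩
    acc + 0             ≡⟨ +-identityʳ acc ⟩
    acc                 ∎

s4-fuel-zero : ∀ f → s4-fuel f 0 ≡ 0
s4-fuel-zero zero    = refl
s4-fuel-zero (suc f) = s4-fuel-zero f

s4-fuel-stable : ∀ f g x → x ≤ f → s4-fuel (f + g) x ≡ s4-fuel f x
s4-fuel-stable zero    g .0 z≤n = s4-fuel-zero g
s4-fuel-stable (suc f) g x x≤1+f =
  cong (x % 4 +_) (s4-fuel-stable f g (x / 4) (quotient-fits x x≤1+f))
  where
  quotient-fits : ∀ y → y ≤ suc f → y / 4 ≤ f
  quotient-fits zero    _     = z≤n
  quotient-fits (suc y) y≤1+f = s≤s⁻¹ (≤-trans (m/n<m (suc y) 4 (s≤s (s≤s z≤n))) y≤1+f)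

s4-fuel-foldl : ∀ ds acc g → All (_< 4) ds →
                s4-fuel (length ds + g) (foldl push acc ds) ≡ sum ds + s4-fuel g acc
s4-fuel-foldl []       acc g []           = refl
s4-fuel-foldl (d ∷ ds) acc g (d<4 ∷ ds<4) = begin
  s4-fuel (suc (length ds + g)) (foldl push (push acc d) ds)
    ≡⟨ cong (λ f → s4-fuel f (foldl push (push acc d) ds)) (sym (+-suc (length ds) g)) ⟩
  s4-fuel (length ds + suc g) (foldl push (push acc d) ds)
    ≡⟨ s4-fuel-foldl ds (push acc d) (suc g) ds<4 ⟩
  sum ds + s4-fuel (suc g) (push acc d)
    ≡⟨ cong (sum ds +_) (s4-fuel-push g acc d<4) ⟩
  sum ds + (d + s4-fuel g acc)
    ≡⟨ sym (+-assoc (sum ds) d _) ⟩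
  sum ds + d + s4-fuel g acc
    ≡⟨ cong (_+ s4-fuel g acc) (+-comm (sum ds) d) ⟩
  d + sum ds + s4-fuel g acc ∎

s₄-fromDigits₄ : ∀ ds → All (_< 4) ds → s₄ (fromDigits₄ ds) ≡ sum ds
s₄-fromDigits₄ ds ds<4 = begin
  s4-fuel x x                  ≡⟨ sym (s4-fuel-stable x (length ds) x ≤-refl) ⟩
  s4-fuel (x + length ds) x    ≡⟨ cong (λ f → s4-fuel f x) (+-comm x (length ds)) ⟩
  s4-fuel (length ds + x) x    ≡⟨ s4-fuel-foldl ds 0 x ds<4 ⟩
  sum ds + s4-fuel x 0         ≡⟨ cong (sum ds +_) (s4-fuel-zero x) ⟩
  sum ds + 0                   ≡⟨ +-identityʳ (sum ds) ⟩
  sum ds                       ∎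
  where
  x = fromDigits₄ ds

expand : List (ℕ × ℕ) → List ℕ
expand []             = []
expand ((d , c) ∷ rs) = replicate c d ++ expand rs

ones : ℕ → ℕ
ones c = fromDigits₄ (replicate c 1)

horner : ℕ → List (ℕ × ℕ) → ℕ
horner acc []             = acc
horner acc ((d , c) ∷ rs) = horner (acc * 4 ^ c + d * ones c) rs

runSum : List (ℕ × ℕ) → ℕ
runSum []             = 0
runSum ((d , c) ∷ rs) = d * c + runSum rs

foldl-push-replicate : ∀ acc d c → foldl push acc (replicate c d) ≡ acc * 4 ^ c + d * ones c
foldl-push-replicate acc d zero    = sym (trans (cong₂ _+_ (*-identityʳ acc) (*-zeroʳ d)) (+-identityʳ acc))
foldl-push-replicate acc d (suc c) = begin
  foldl push (push acc d) (replicate c d)    ≡⟨ foldl-push-replicate (push acc d) d c ⟩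
  push acc d * 4 ^ c + d * ones c            ≡⟨ regroup acc d (4 ^ c) (ones c) ⟩
  acc * (4 * 4 ^ c) + d * (1 * 4 ^ c + 1 * ones c)
    ≡⟨ cong (λ v → acc * (4 * 4 ^ c) + d * v) (sym (foldl-push-replicate 1 1 c)) ⟩
  acc * 4 ^ suc c + d * ones (suc c)         ∎
  where
  regroup : ∀ a d p o → (4 * a + d) * p + d * o ≡ a * (4 * p) + d * (1 * p + 1 * o)
  regroup = solve-∀

-- (1^(c))₄ = (4^c - 1) / 3, stated without subtraction or division.
ones-power : ∀ c → 3 * ones c + 1 ≡ 4 ^ c
ones-power zero    = refl
ones-power (suc c) = begin
  3 * ones (suc c) + 1               ≡⟨ cong (λ v → 3 * v + 1) (foldl-push-replicate 1 1 c) ⟩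
  3 * (1 * 4 ^ c + 1 * ones c) + 1   ≡⟨ regroup (4 ^ c) (ones c) ⟩
  3 * 4 ^ c + (3 * ones c + 1)       ≡⟨ cong (3 * 4 ^ c +_) (ones-power c) ⟩
  3 * 4 ^ c + 4 ^ c                  ≡⟨ +-comm (3 * 4 ^ c) (4 ^ c) ⟩
  4 * 4 ^ c                          ∎
  where
  regroup : ∀ p o → 3 * (1 * p + 1 * o) + 1 ≡ 3 * p + (3 * o + 1)
  regroup = solve-∀

foldl-push-expand : ∀ acc rs → foldl push acc (expand rs) ≡ horner acc rs
foldl-push-expand acc []             = refl
foldl-push-expand acc ((d , c) ∷ rs) = begin
  foldl push acc (replicate c d ++ expand rs)          ≡⟨ foldl-++ push acc (replicate c d) (expand rs) ⟩
  foldl push (foldl push acc (replicate c d)) (expand rs)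
    ≡⟨ cong (λ a → foldl push a (expand rs)) (foldl-push-replicate acc d c) ⟩
  foldl push (acc * 4 ^ c + d * ones c) (expand rs)    ≡⟨ foldl-push-expand _ rs ⟩
  horner acc ((d , c) ∷ rs)                            ∎

expand-digits : ∀ rs → All (λ r → proj₁ r < 4) rs → All (_< 4) (expand rs)
expand-digits []             []           = []
expand-digits ((d , c) ∷ rs) (d<4 ∷ rs<4) = ++⁺ (replicate⁺ c d<4) (expand-digits rs rs<4)

sum-expand : ∀ rs → sum (expand rs) ≡ runSum rs
sum-expand []             = refl
sum-expand ((d , c) ∷ rs) = begin
  sum (replicate c d ++ expand rs)      ≡⟨ sum-++ (replicate c d) (expand rs) ⟩
  sum (replicate c d) + sum (expand rs) ≡⟨ cong₂ _+_ (sum-replicate c) (sum-expand rs) ⟩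
  d * c + runSum rs                     ∎
  where
  sum-replicate : ∀ c → sum (replicate c d) ≡ d * c
  sum-replicate zero    = sym (*-zeroʳ d)
  sum-replicate (suc c) = trans (cong (d +_) (sum-replicate c)) (sym (*-suc d c))

s₄-runs : ∀ rs → All (λ r → proj₁ r < 4) rs → s₄ (horner 0 rs) ≡ runSum rs
s₄-runs rs rs<4 = begin
  s₄ (horner 0 rs)             ≡⟨ cong s₄ (sym (foldl-push-expand 0 rs)) ⟩
  s₄ (fromDigits₄ (expand rs)) ≡⟨ s₄-fromDigits₄ (expand rs) (expand-digits rs rs<4) ⟩
  sum (expand rs)              ≡⟨ sum-expand rs ⟩
  runSum rs                    ∎

uRuns : ℕ → ℕ → List (ℕ × ℕ)
uRuns k n = (1 , 1) ∷ (3 , k) ∷ (2 , 1) ∷ (3 , n) ∷ []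

u-horner : ∀ k n → u k n ≡ horner 0 (uRuns k n)
u-horner k n = begin
  u k n
    ≡⟨ cong (λ t → fromDigits₄ (1 ∷ replicate k 3 ++ 2 ∷ t)) (sym (++-identityʳ (replicate n 3))) ⟩
  fromDigits₄ (expand (uRuns k n)) ≡⟨ foldl-push-expand 0 (uRuns k n) ⟩
  horner 0 (uRuns k n)             ∎

twiceSquareRuns : ℕ → ℕ → List (ℕ × ℕ)
twiceSquareRuns k m =
  (1 , 1) ∷ (3 , k) ∷ (2 , 1) ∷ (0 , suc k) ∷ (1 , 1) ∷ (3 , m) ∷ (2 , 1) ∷
  (0 , k) ∷ (1 , 1) ∷ (0 , k + 3 + m) ∷ (2 , 1) ∷ []

-- The Horner values of uRuns and twiceSquareRuns as polynomials in A = 4^k,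
-- p = ones k, B = 4^m, q = ones m, N = 4^n, r = ones n (a 0-run contributes
-- "+ 0"); they agree definitionally with horner 0 (uRuns k n) etc.
uValue : ℕ → ℕ → ℕ → ℕ → ℕ
uValue A p N r = ((1 * A + 3 * p) * 4 + 2) * N + 3 * r

leadingValue : ℕ → ℕ → ℕ → ℕ → ℕ
leadingValue A p B q =
  (((((((1 * A + 3 * p) * 4 + 2) * (4 * A) + 0) * 4 + 1) * B + 3 * q) * 4 + 2) * A + 0) * 4 + 1

twiceSquareValue : ℕ → ℕ → ℕ → ℕ → ℕ → ℕ
twiceSquareValue A p B q N = (leadingValue A p B q * N + 0) * 4 + 2

-- u + 1 = cN with c = 8A - 1 = 24p + 7.
u-plus-one : ∀ {A N p r} → 3 * p + 1 ≡ A → 3 * r + 1 ≡ N →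
             uValue A p N r + 1 ≡ (24 * p + 7) * N
u-plus-one {p = p} {r} refl refl = identity p r
  where
  identity : ∀ p r → ((1 * (3 * p + 1) + 3 * p) * 4 + 2) * (3 * r + 1) + 3 * r + 1
                     ≡ (24 * p + 7) * (3 * r + 1)
  identity = solve-∀

leading-plus : ∀ {A B p q} → 3 * p + 1 ≡ A → 3 * q + 1 ≡ B →
               leadingValue A p B q + (24 * p + 7) ≡ 32 * (24 * p + 7) * (24 * p + 7) * (A * B)
leading-plus {p = p} {q} refl refl = identity p q
  where
  identity : ∀ p q → let A = 3 * p + 1; B = 3 * q + 1 in
    (((((((1 * A + 3 * p) * 4 + 2) * (4 * A) + 0) * 4 + 1) * B + 3 * q) * 4 + 2) * A + 0) * 4 + 1
      + (24 * p + 7) ≡ 32 * (24 * p + 7) * (24 * p + 7) * (A * B)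
  identity = solve-∀

trailing-plus : ∀ {Y c P N} → Y + c ≡ 32 * c * c * P → 64 * P ≡ N →
                (Y * N + 0) * 4 + 2 + 4 * (c * N) ≡ 2 * ((c * N) * (c * N)) + 2
trailing-plus {Y} {c} {P} Y+c≡ refl = begin
  (Y * (64 * P) + 0) * 4 + 2 + 4 * (c * (64 * P)) ≡⟨ collect Y c P ⟩
  256 * P * (Y + c) + 2                           ≡⟨ cong (λ v → 256 * P * v + 2) Y+c≡ ⟩
  256 * P * (32 * c * c * P) + 2                  ≡⟨ square c P ⟩
  2 * ((c * (64 * P)) * (c * (64 * P))) + 2       ∎
  where
  collect : ∀ Y c P → (Y * (64 * P) + 0) * 4 + 2 + 4 * (c * (64 * P)) ≡ 256 * P * (Y + c) + 2
  collect = solve-∀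
  square : ∀ c P → 256 * P * (32 * c * c * P) + 2 ≡ 2 * ((c * (64 * P)) * (c * (64 * P))) + 2
  square = solve-∀

twice-square-from-shift : ∀ {v W M} → v + 1 ≡ M → W + 4 * M ≡ 2 * (M * M) + 2 → 2 * (v * v) ≡ W
twice-square-from-shift {v} {W} refl W+4M≡ =
  sym (+-cancelʳ-≡ (4 * (v + 1)) W (2 * (v * v)) (trans W+4M≡ (expand-square v)))
  where
  expand-square : ∀ v → 2 * ((v + 1) * (v + 1)) + 2 ≡ 2 * (v * v) + 4 * (v + 1)
  expand-square = solve-∀

-- 2u² has the claimed expansion, as an identity between the Horner values under
-- the relations A = 3p + 1, B = 3q + 1, N = 64AB = 3r + 1: with M = u + 1 = cN,
-- both 2u² + 4M and twiceSquareValue + 4M equal 2M² + 2.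
twice-square-value : ∀ {A B N p q r} →
  3 * p + 1 ≡ A → 3 * q + 1 ≡ B → 64 * (A * B) ≡ N → 3 * r + 1 ≡ N →
  2 * (uValue A p N r * uValue A p N r) ≡ twiceSquareValue A p B q N
twice-square-value {A} {B} {N} {p} {q} {r} hA hB hN hr =
  twice-square-from-shift (u-plus-one {A} {N} {p} {r} hA hr)
    (trailing-plus {leadingValue A p B q} (leading-plus {A} {B} {p} {q} hA hB) hN)

twice-square-horner : ∀ k m → let n = k + 3 + m in
                      2 * (u k n * u k n) ≡ horner 0 (twiceSquareRuns k m)
twice-square-horner k m = begin
  2 * (u k n * u k n)                      ≡⟨ cong (λ v → 2 * (v * v)) (u-horner k n) ⟩
  2 * (horner 0 (uRuns k n) * horner 0 (uRuns k n))
    ≡⟨ twice-square-value {p = ones k} {ones m} {ones n} (ones-power k) (ones-power m) power-split (ones-power n) ⟩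
  horner 0 (twiceSquareRuns k m)           ∎
  where
  n = k + 3 + m
  power-split : 64 * (4 ^ k * 4 ^ m) ≡ 4 ^ n
  power-split = begin
    64 * (4 ^ k * 4 ^ m)  ≡⟨ sym (*-assoc 64 (4 ^ k) (4 ^ m)) ⟩
    64 * 4 ^ k * 4 ^ m    ≡⟨ cong (_* 4 ^ m) (*-comm 64 (4 ^ k)) ⟩
    4 ^ k * 4 ^ 3 * 4 ^ m ≡⟨ cong (_* 4 ^ m) (sym (^-distribˡ-+-* 4 k 3)) ⟩
    4 ^ (k + 3) * 4 ^ m   ≡⟨ sym (^-distribˡ-+-* 4 (k + 3) m) ⟩
    4 ^ n                 ∎

twice-square-digits : ∀ k m → All (λ r → proj₁ r < 4) (twiceSquareRuns k m)
twice-square-digits k m = toWitness {a? = all? (λ r → proj₁ r <? 4) (twiceSquareRuns k m)} tt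

twice-square-digit-sum : ∀ k m → runSum (twiceSquareRuns k m) ≡ 3 * (k + 3 + m)
twice-square-digit-sum = arithmetic
  where
  arithmetic : ∀ k m → 1 + (3 * k + (2 + (1 + (3 * m + (2 + (1 + 2)))))) ≡ 3 * (k + 3 + m)
  arithmetic = solve-∀

lemma3p10 : (k n : ℕ) → 1 ≤ k → k + 3 ≤ n →
            s₄ (2 * (u k n * u k n)) ≡ 3 * n
lemma3p10 k n _ k+3≤n with m≤n⇒∃[o]m+o≡n k+3≤n
... | m , refl = begin
  s₄ (2 * (u k n * u k n))             ≡⟨ cong s₄ (twice-square-horner k m) ⟩
  s₄ (horner 0 (twiceSquareRuns k m))  ≡⟨ s₄-runs (twiceSquareRuns k m) (twice-square-digits k m) ⟩
  runSum (twiceSquareRuns k m)         ≡⟨ twice-square-digit-sum k m ⟩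
  3 * n                                ∎
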